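{- Let $z\in S_\infty$ be an involution. Then $k(z)\ge\textsf{cyc}(z)$, with equality if and only if $z$ is quasi-dominant.
   Context: $S_\infty$: permutations of $\mathbb{Z}$ fixing $i\le0$ and all but finitely many $i$. $k(z)=\min\{i\in\mathbb{Z}_{\ge0}:z(j)\le j\text{ for all }j>i\}$; $\textsf{cyc}(z)=|\{a\in\mathbb{Z}_{>0}:a<z(a)\}|$. An involution $z$ is quasi-dominant if $i-1<z(i-1)$ whenever $1<i<z(i)$. -}

module Defs where

open import Data.Nat using (ℕ; zero; suc; _+_; _∸_; _≤_; _<_; _<?_)
open import Data.Product using (Σ; _×_)
open import Relation.Binary.PropositionalEquality using (_≡_)
open import Relation.Nullary using (yes; no)

-- An element of S_∞ fixes every i ≤ 0, so it is determined by its restriction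
-- to ℕ = {0,1,2,...} (which it preserves), with 0 fixed.
record InvolutionS∞ : Set where
  field
    z        : ℕ → ℕ
    fix0     : z 0 ≡ 0
    involutive : ∀ i → z (z i) ≡ i
    bound    : ℕ
    finSupp  : ∀ i → bound < i → z i ≡ i
open InvolutionS∞ public

countExc : (ℕ → ℕ) → ℕ → ℕ
countExc f zero = 0
countExc f (suc n) with suc n <? f (suc n)
... | yes _ = suc (countExc f n)
... | no  _ = countExc f n

-- cyc(z) = |{a ∈ ℤ_{>0} : a < z(a)}|; all such a lie in {1,…,bound}.
cyc : InvolutionS∞ → ℕ
cyc w = countExc (z w) (bound w)

Tail≤ : (ℕ → ℕ) → ℕ → Set
Tail≤ f i = ∀ j → i < j → f j ≤ j

IsK : InvolutionS∞ → ℕ → Set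
IsK w m = Tail≤ (z w) m × (∀ i → Tail≤ (z w) i → m ≤ i)

QuasiDominant : InvolutionS∞ → Set
QuasiDominant w = ∀ i → 1 < i → i < z w i → i ∸ 1 < z w (i ∸ 1)

-- Let m = k(z). Every a with a < z(a) satisfies a ≤ m, so cyc(z) counts
-- exceedances among 1,…,m and is at most m, with equality iff every
-- 1 ≤ a ≤ m is an exceedance. Minimality of m makes m itself an exceedance
-- (when m > 0), and quasi-dominance is exactly the condition that lets an
-- exceedance at i propagate to i − 1; so both conditions say the same thing.
module Submission where

open import Defs
open import Data.Nat using (ℕ; zero; suc; _+_; _∸_; _≤_; _<_; _<?_; z≤n; s≤s)
open import Data.Nat.Properties
open import Data.Product using (_×_; _,_)
open import Data.Sum using (inj₁; inj₂)
open import Data.Empty using (⊥-elim)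
open import Function.Bundles using (_⇔_; mk⇔)
import Function.Properties.Equivalence as ⇔
open import Relation.Binary.PropositionalEquality using (_≡_; refl; sym; cong; subst)
open import Relation.Nullary using (yes; no)

AllExceed : (ℕ → ℕ) → ℕ → Set
AllExceed f n = ∀ j → 1 ≤ j → j ≤ n → j < f j

QuasiDominantMap : (ℕ → ℕ) → Set
QuasiDominantMap f = ∀ i → 1 < i → i < f i → i ∸ 1 < f (i ∸ 1)

LeastTail : (ℕ → ℕ) → ℕ → Set
LeastTail f m = Tail≤ f m × (∀ i → Tail≤ f i → m ≤ i)

countExc-≤ : ∀ f n → countExc f n ≤ n
countExc-≤ f zero = z≤n
countExc-≤ f (suc n) with suc n <? f (suc n)
... | yes _ = s≤s (countExc-≤ f n)
... | no  _ = m≤n⇒m≤1+n (countExc-≤ f n)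

countExc-+-tail : ∀ f {a} d → Tail≤ f a → countExc f (d + a) ≡ countExc f a
countExc-+-tail f zero t = refl
countExc-+-tail f {a} (suc d) t with suc (d + a) <? f (suc (d + a))
... | yes p = ⊥-elim (<⇒≱ p (t (suc (d + a)) (s≤s (m≤n+m a d))))
... | no  _ = countExc-+-tail f d t

countExc-tail : ∀ f {a n} → Tail≤ f a → a ≤ n → countExc f n ≡ countExc f a
countExc-tail f {a} {n} t a≤n =
  subst (λ x → countExc f x ≡ countExc f a) (m∸n+n≡m a≤n) (countExc-+-tail f (n ∸ a) t)

countExc≡n⇔allExceed : ∀ f n → (countExc f n ≡ n) ⇔ AllExceed f n
countExc≡n⇔allExceed f n = mk⇔ (to n) (from n)
  where
  to : ∀ n → countExc f n ≡ n → AllExceed f n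
  to zero e j 1≤j j≤0 = ⊥-elim (<⇒≱ 1≤j j≤0)
  to (suc n) e j 1≤j j≤n+1 with suc n <? f (suc n) | m≤n⇒m<n∨m≡n j≤n+1
  ... | yes _ | inj₁ j<n+1 = to n (suc-injective e) j 1≤j (≤-pred j<n+1)
  ... | yes p | inj₂ refl  = p
  ... | no  _ | _          = ⊥-elim (<⇒≱ (s≤s (countExc-≤ f n)) (≤-reflexive (sym e)))

  from : ∀ n → AllExceed f n → countExc f n ≡ n
  from zero _ = refl
  from (suc n) h with suc n <? f (suc n)
  ... | yes _ = cong suc (from n (λ j 1≤j j≤n → h j 1≤j (m≤n⇒m≤1+n j≤n)))
  ... | no  q = ⊥-elim (q (h (suc n) (s≤s z≤n) ≤-refl))

exceedance-≤-tail : ∀ f {m i} → Tail≤ f m → i < f i → i ≤ m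
exceedance-≤-tail f {m} {i} t i<fi with m <? i
... | yes m<i = ⊥-elim (<⇒≱ i<fi (t i m<i))
... | no  m≮i = ≮⇒≥ m≮i

leastTail-exceeds : ∀ f {m} → LeastTail f m → 0 < m → m < f m
leastTail-exceeds f {suc m} (t , least) _ with suc m <? f (suc m)
... | yes p = p
... | no  q = ⊥-elim (<⇒≱ ≤-refl (least m tail))
  where
  tail : Tail≤ f m
  tail j m<j with m≤n⇒m<n∨m≡n m<j
  ... | inj₁ m+1<j = t j m+1<j
  ... | inj₂ refl  = ≮⇒≥ q

quasiDominant-exceeds-downward : ∀ f → QuasiDominantMap f →
  ∀ d {j} → 1 ≤ j → d + j < f (d + j) → j < f j
quasiDominant-exceeds-downward f q zero 1≤j e = e
quasiDominant-exceeds-downward f q (suc d) {j} 1≤j e =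
  quasiDominant-exceeds-downward f q d 1≤j
    (q (suc d + j) (s≤s (≤-trans 1≤j (m≤n+m j d))) e)

quasiDominant⇔allExceed : ∀ f {m} → LeastTail f m → QuasiDominantMap f ⇔ AllExceed f m
quasiDominant⇔allExceed f {m} (t , least) = mk⇔ to from
  where
  to : QuasiDominantMap f → AllExceed f m
  to q j 1≤j j≤m = quasiDominant-exceeds-downward f q (m ∸ j) 1≤j
    (subst (λ x → x < f x) (sym (m∸n+n≡m j≤m))
      (leastTail-exceeds f (t , least) (<-≤-trans 1≤j j≤m)))

  from : AllExceed f m → QuasiDominantMap f
  from h i 1<i i<fi =
    h (i ∸ 1) (∸-monoˡ-≤ 1 1<i) (≤-trans (m∸n≤m i 1) (exceedance-≤-tail f t i<fi))

cyc≡countExc-leastTail : ∀ w {m} → LeastTail (z w) m → cyc w ≡ countExc (z w) m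
cyc≡countExc-leastTail w (tail , least) = countExc-tail (z w) tail
  (least (bound w) (λ j bound<j → ≤-reflexive (finSupp w j bound<j)))

proposition3p1 : (w : InvolutionS∞) (m : ℕ) → IsK w m →
    (cyc w ≤ m) × ((cyc w ≡ m) ⇔ QuasiDominant w)
proposition3p1 w m k rewrite cyc≡countExc-leastTail w k =
  countExc-≤ (z w) m ,
  ⇔.trans (countExc≡n⇔allExceed (z w) m) (⇔.sym (quasiDominant⇔allExceed (z w) k))
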